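{- Let $G$ be a finite simple graph without isolated vertices such that $M(G)$ is connected. Then any two vertices of the 1-skeleton of $M(G)$ are joined by a path of length at most 4; that is, the 1-skeleton of $M(G)$ has diameter at most 4.
   Context: The matching complex $M(G)$ is the simplicial complex whose vertex set is $E(G)$ and whose faces are the matchings of $G$ (sets of pairwise vertex-disjoint edges). -}

module Defs where

open import Data.Nat using (ℕ; zero; suc)
open import Data.Bool using (Bool; true; false)
open import Data.Fin using (Fin; _<_)
open import Data.Product using (Σ; ∃; _×_; _,_)
open import Relation.Binary.PropositionalEquality using (_≡_; _≢_)

record SimpleGraph : Set where
  field
    n      : ℕ
    adj    : Fin n → Fin n → Bool
    sym    : ∀ u v → adj u v ≡ adj v u
    irrefl : ∀ v → adj v v ≡ false

open SimpleGraph public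

NoIsolatedVertices : SimpleGraph → Set
NoIsolatedVertices G = ∀ (v : Fin (n G)) → ∃ λ w → adj G v w ≡ true

-- Edge set E(G): each edge {u,v} represented uniquely as (u , v) with u < v.
record Edge (G : SimpleGraph) : Set where
  constructor edge
  field
    lo    : Fin (n G)
    hi    : Fin (n G)
    lo<hi : lo < hi
    isAdj : adj G lo hi ≡ true

open Edge public

-- Two edges are vertex-disjoint (so {e, f} is a matching, i.e. an edge of M(G)).
Disjoint : {G : SimpleGraph} → Edge G → Edge G → Set
Disjoint e f =
  (lo e ≢ lo f) × (lo e ≢ hi f) × (hi e ≢ lo f) × (hi e ≢ hi f)

-- Walks of length k in the 1-skeleton of M(G): vertices are edges of G,
-- adjacent iff they form a 2-element matching (are vertex-disjoint).
data Walk {G : SimpleGraph} : Edge G → Edge G → ℕ → Set where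
  here : ∀ {e} → Walk e e zero
  step : ∀ {e f g k} → Disjoint e f → Walk f g k → Walk e g (suc k)

-- M(G) is connected: any two of its vertices are joined by a walk in its
-- 1-skeleton (a simplicial complex is connected iff its 1-skeleton is).
MatchingComplexConnected : SimpleGraph → Set
MatchingComplexConnected G = ∀ (e f : Edge G) → ∃ λ k → Walk e f k

-- Let e = ab and f = ac share the vertex a (disjoint or equal e, f are trivial).
-- By connectivity some edge h is disjoint from f; if h misses b then e, h, f is
-- a path, so let h = by. A walk from e to f starts in the closed neighbourhood
-- N[e] = {e} ∪ {w | w disjoint from e} of e in M(G) and ends outside it, since f
-- meets e. A step w → w′ leaving N[e] exhibits one of the paths e w f, e w h f,
-- e w w′ f, e w w′ h f, unless w contains c and y and w′ = ab = e.
module Submission where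

open import Defs
open import Data.Nat using (_≤_)
open import Data.Product using (∃; _×_)

open import Data.Nat using (zero; suc; z≤n; s≤s)
open import Data.Bool using () renaming (_≟_ to _≟ᵇ_)
open import Data.Fin using (Fin; _≟_)
open import Data.Fin.Properties using (<-irrelevant; <-irrefl; <-asym)
open import Data.Product using (_,_; proj₂)
open import Data.Sum using (_⊎_; inj₁; inj₂; [_,_])
open import Function using (_∘_)
open import Relation.Nullary using (¬_; yes; no; contradiction)
open import Relation.Nullary.Decidable using (Dec; _⊎-dec_; map′)
open import Relation.Binary.PropositionalEquality
  using (_≡_; _≢_; refl; cong₂; subst)
  renaming (sym to ≡-sym)
open import Axiom.UniquenessOfIdentityProofs using (module Decidable⇒UIP)

module _ {G : SimpleGraph} where

  private
    V = Fin (n G)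
    E = Edge G

  infix 4 _∈ₑ_ _∉ₑ_ _∈ₑ?_

  data _∈ₑ_ (v : V) (u : E) : Set where
    lo∈ : v ≡ lo u → v ∈ₑ u
    hi∈ : v ≡ hi u → v ∈ₑ u

  _∉ₑ_ : V → E → Set
  v ∉ₑ u = ¬ v ∈ₑ u

  _∈ₑ?_ : (v : V) (u : E) → Dec (v ∈ₑ u)
  v ∈ₑ? u = map′ [ lo∈ , hi∈ ] (λ { (lo∈ p) → inj₁ p ; (hi∈ p) → inj₂ p })
    ((v ≟ lo u) ⊎-dec (v ≟ hi u))

  data Joins (u : E) (a b : V) : Set where
    lo-hi : lo u ≡ a → hi u ≡ b → Joins u a b
    hi-lo : hi u ≡ a → lo u ≡ b → Joins u a b

  lo≢hi : (u : E) → lo u ≢ hi u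
  lo≢hi u eq = <-irrefl eq (lo<hi u)

  edge-ext : ∀ {u w : E} → lo u ≡ lo w → hi u ≡ hi w → u ≡ w
  edge-ext {edge l h p q} {edge .l .h p′ q′} refl refl =
    cong₂ (edge l h) (<-irrelevant p p′) (Decidable⇒UIP.≡-irrelevant _≟ᵇ_ q q′)

  joins-lo-hi : (u : E) → Joins u (lo u) (hi u)
  joins-lo-hi u = lo-hi refl refl

  joins-swap : ∀ {u a b} → Joins u a b → Joins u b a
  joins-swap (lo-hi p q) = hi-lo q p
  joins-swap (hi-lo p q) = lo-hi q p

  joins-≢ : ∀ {u a b} → Joins u a b → a ≢ b
  joins-≢ {u} (lo-hi refl refl) = lo≢hi u
  joins-≢ {u} (hi-lo refl refl) = lo≢hi u ∘ ≡-sym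

  joins-∈ˡ : ∀ {u a b} → Joins u a b → a ∈ₑ u
  joins-∈ˡ (lo-hi p _) = lo∈ (≡-sym p)
  joins-∈ˡ (hi-lo p _) = hi∈ (≡-sym p)

  joins-∈ʳ : ∀ {u a b} → Joins u a b → b ∈ₑ u
  joins-∈ʳ = joins-∈ˡ ∘ joins-swap

  ∈-joins : ∀ {u a b v} → Joins u a b → v ∈ₑ u → v ≡ a ⊎ v ≡ b
  ∈-joins (lo-hi refl refl) (lo∈ p) = inj₁ p
  ∈-joins (lo-hi refl refl) (hi∈ p) = inj₂ p
  ∈-joins (hi-lo refl refl) (lo∈ p) = inj₂ p
  ∈-joins (hi-lo refl refl) (hi∈ p) = inj₁ p

  ∈⇒joins : ∀ {u v} → v ∈ₑ u → ∃ λ x → Joins u v x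
  ∈⇒joins {u} (lo∈ refl) = hi u , lo-hi refl refl
  ∈⇒joins {u} (hi∈ refl) = lo u , hi-lo refl refl

  ∈∈⇒joins : ∀ {u a b} → a ∈ₑ u → b ∈ₑ u → a ≢ b → Joins u a b
  ∈∈⇒joins a∈u b∈u a≢b with ∈⇒joins a∈u
  ... | x , J with ∈-joins J b∈u
  ...   | inj₁ b≡a = contradiction (≡-sym b≡a) a≢b
  ...   | inj₂ refl = J

  joins-unique : ∀ {u w a b} → Joins u a b → Joins w a b → u ≡ w
  joins-unique (lo-hi refl refl) (lo-hi p q) = edge-ext (≡-sym p) (≡-sym q)
  joins-unique (hi-lo refl refl) (hi-lo p q) = edge-ext (≡-sym q) (≡-sym p)
  joins-unique {u} {w} (lo-hi refl refl) (hi-lo refl refl) =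
    contradiction (lo<hi u) (<-asym (lo<hi w))
  joins-unique {u} {w} (hi-lo refl refl) (lo-hi refl refl) =
    contradiction (lo<hi u) (<-asym (lo<hi w))

  disjoint-intro : ∀ {u w : E} → (∀ {v} → v ∈ₑ u → v ∉ₑ w) → Disjoint u w
  disjoint-intro ∉w =
      ∉w (lo∈ refl) ∘ lo∈ , ∉w (lo∈ refl) ∘ hi∈
    , ∉w (hi∈ refl) ∘ lo∈ , ∉w (hi∈ refl) ∘ hi∈

  disjoint-∉ : ∀ {u w : E} {v} → Disjoint u w → v ∈ₑ u → v ∉ₑ w
  disjoint-∉ (p , _ , _ , _) (lo∈ refl) (lo∈ eq) = p eq
  disjoint-∉ (_ , q , _ , _) (lo∈ refl) (hi∈ eq) = q eq
  disjoint-∉ (_ , _ , r , _) (hi∈ refl) (lo∈ eq) = r eq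
  disjoint-∉ (_ , _ , _ , s) (hi∈ refl) (hi∈ eq) = s eq

  disjoint-∉ʳ : ∀ {u w : E} {v} → Disjoint u w → v ∈ₑ w → v ∉ₑ u
  disjoint-∉ʳ d v∈w v∈u = disjoint-∉ d v∈u v∈w

  disjoint-sym : ∀ {u w : E} → Disjoint u w → Disjoint w u
  disjoint-sym {u} {w} d = disjoint-intro λ v∈w v∈u → disjoint-∉ {u} {w} d v∈u v∈w

  joins-disjoint : ∀ {u w a b} → Joins u a b → a ∉ₑ w → b ∉ₑ w → Disjoint u w
  joins-disjoint J a∉w b∉w = disjoint-intro λ v∈u →
    [ (λ { refl → a∉w }) , (λ { refl → b∉w }) ] (∈-joins J v∈u)

  disjoint-joins : ∀ {u w a b} → Joins u a b → a ∉ₑ w → b ∉ₑ w → Disjoint w u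
  disjoint-joins {u} {w} J a∉w b∉w = disjoint-sym {u} {w} (joins-disjoint J a∉w b∉w)

  has-neighbour : MatchingComplexConnected G → ∀ f e → f ≢ e → ∃ λ h → Disjoint h f
  has-neighbour conn f e f≢e with conn f e
  ... | zero , here = contradiction refl f≢e
  ... | suc _ , step {f = h} fh _ = h , disjoint-sym {f} {h} fh

  walk-invariant : ∀ {R : Set} (P : E → Set) →
    (∀ {w w′} → P w → Disjoint w w′ → R ⊎ P w′) →
    ∀ {s t k} → Walk s t k → P s → R ⊎ P t
  walk-invariant P step-P here      Ps = inj₂ Ps
  walk-invariant P step-P (step d ω) Ps with step-P Ps d
  ... | inj₁ r   = inj₁ r
  ... | inj₂ Pw′ = walk-invariant P step-P ω Pw′

  Dist≤4 : E → E → Set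
  Dist≤4 e f = ∃ λ k → (k ≤ 4) × Walk e f k

  path₂ : ∀ {e f : E} w → Disjoint e w → Disjoint w f → Dist≤4 e f
  path₂ w d₁ d₂ = 2 , s≤s (s≤s z≤n) , step {f = w} d₁ (step d₂ here)

  path₃ : ∀ {e f : E} w w′ → Disjoint e w → Disjoint w w′ → Disjoint w′ f → Dist≤4 e f
  path₃ w w′ d₁ d₂ d₃ =
    3 , s≤s (s≤s (s≤s z≤n)) , step {f = w} d₁ (step {f = w′} d₂ (step d₃ here))

  path₄ : ∀ {e f : E} w w′ w″ → Disjoint e w → Disjoint w w′ → Disjoint w′ w″ →
          Disjoint w″ f → Dist≤4 e f
  path₄ w w′ w″ d₁ d₂ d₃ d₄ = 4 , s≤s (s≤s (s≤s (s≤s z≤n))) ,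
    step {f = w} d₁ (step {f = w′} d₂ (step {f = w″} d₃ (step d₄ here)))

  ClosedNeighbour : E → E → Set
  ClosedNeighbour e w = w ≡ e ⊎ Disjoint e w

  module SharedVertex {e f : E} {a b c : V}
    (Je : Joins e a b) (Jf : Joins f a c) (b≢c : b ≢ c) where

    b∉f : b ∉ₑ f
    b∉f b∈f = [ joins-≢ Je ∘ ≡-sym , b≢c ] (∈-joins Jf b∈f)

    f≢e : f ≢ e
    f≢e refl = b∉f (joins-∈ʳ Je)

    ∉f-closedNeighbour : ¬ ClosedNeighbour e f
    ∉f-closedNeighbour (inj₁ f≡e) = f≢e f≡e
    ∉f-closedNeighbour (inj₂ d)    = disjoint-∉ d (joins-∈ˡ Je) (joins-∈ˡ Jf)

    module _ {h : E} {y : V} (Jh : Joins h b y) (hf : Disjoint h f) where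

      closedNeighbour-step : ∀ {w w′} → ClosedNeighbour e w → Disjoint w w′ →
        Dist≤4 e f ⊎ ClosedNeighbour e w′
      closedNeighbour-step (inj₁ refl) d = inj₂ (inj₂ d)
      closedNeighbour-step {w} {w′} (inj₂ ew) ww′ with c ∈ₑ? w
      ... | no c∉w = inj₁ (path₂ w ew (disjoint-joins Jf a∉w c∉w))
        where
        a∉w : a ∉ₑ w
        a∉w = disjoint-∉ ew (joins-∈ˡ Je)
      ... | yes c∈w with y ∈ₑ? w
      ...   | no y∉w = inj₁ (path₃ w h ew (disjoint-joins Jh b∉w y∉w) hf)
        where
        b∉w : b ∉ₑ w
        b∉w = disjoint-∉ ew (joins-∈ʳ Je)
      ...   | yes y∈w with b ∈ₑ? w′
      ...     | no b∉w′ = inj₁ (path₄ w w′ h ew ww′ w′h hf)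
        where
        w′h : Disjoint w′ h
        w′h = disjoint-joins Jh b∉w′ (disjoint-∉ ww′ y∈w)
      ...     | yes b∈w′ with a ∈ₑ? w′
      ...       | no a∉w′ =
        inj₁ (path₃ w w′ ew ww′ (disjoint-joins Jf a∉w′ (disjoint-∉ ww′ c∈w)))
      ...       | yes a∈w′ =
        inj₂ (inj₁ (joins-unique (∈∈⇒joins a∈w′ b∈w′ (joins-≢ Je)) Je))

      dist≤4-from-walk : ∀ {k} → Walk e f k → Dist≤4 e f
      dist≤4-from-walk ω
        with walk-invariant (ClosedNeighbour e) closedNeighbour-step ω (inj₁ refl)
      ... | inj₁ short = short
      ... | inj₂ f∈N[e] = contradiction f∈N[e] ∉f-closedNeighbour

    dist≤4 : MatchingComplexConnected G → Dist≤4 e f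
    dist≤4 conn with has-neighbour conn f e f≢e
    ... | h , hf with b ∈ₑ? h
    ...   | no b∉h = path₂ h (joins-disjoint Je (disjoint-∉ʳ hf (joins-∈ˡ Jf)) b∉h) hf
    ...   | yes b∈h with ∈⇒joins b∈h
    ...     | y , Jh = dist≤4-from-walk Jh hf (proj₂ (conn e f))

  disjoint-or-share : (e f : E) →
    Disjoint e f ⊎ ∃ λ a → ∃ λ b → ∃ λ c → Joins e a b × Joins f a c
  disjoint-or-share e f with lo e ∈ₑ? f | hi e ∈ₑ? f
  ... | yes lo∈f | _ with ∈⇒joins lo∈f
  ...   | c , Jf = inj₂ (lo e , hi e , c , joins-lo-hi e , Jf)
  disjoint-or-share e f | no _ | yes hi∈f with ∈⇒joins hi∈f
  ...   | c , Jf = inj₂ (hi e , lo e , c , joins-swap (joins-lo-hi e) , Jf)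
  disjoint-or-share e f | no lo∉f | no hi∉f =
    inj₁ (joins-disjoint (joins-lo-hi e) lo∉f hi∉f)

corollary3p2 : (G : SimpleGraph) → NoIsolatedVertices G → MatchingComplexConnected G →
    ∀ (e f : Edge G) → ∃ λ k → (k ≤ 4) × Walk e f k
corollary3p2 G _ conn e f with disjoint-or-share e f
... | inj₁ d = 1 , s≤s z≤n , step d here
... | inj₂ (a , b , c , Je , Jf) with b ≟ c
...   | yes refl = 0 , z≤n , subst (λ t → Walk e t 0) (joins-unique Je Jf) here
...   | no b≢c = SharedVertex.dist≤4 Je Jf b≢c conn
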